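{- A (possibly disconnected) trivially perfect graph whose true twin classes all have size at most $t$ and whose maximum independent set has size $\alpha$ has at most $(2\alpha-1)t$ vertices.
   Context: Graphs are finite, simple, undirected; a graph is trivially perfect if it has no induced $C_4$ or $P_4$. Vertices $u,v$ are true twins if $N[u]=N[v]$; a true twin class is an inclusion-wise maximal set of pairwise true twins. -}

module Defs where

open import Data.Nat using (ℕ; _≤_)
open import Data.Fin using (Fin)
open import Data.Fin.Subset using (Subset; _∈_; ∣_∣)
open import Data.Product using (_×_; Σ)
open import Data.Sum using (_⊎_)
open import Relation.Nullary using (¬_; Dec)
open import Relation.Binary.PropositionalEquality using (_≡_; _≢_)
open import Function.Bundles using (_⇔_)
open import Level using (0ℓ)

record Graph (n : ℕ) : Set₁ where
  field
    Adj      : Fin n → Fin n → Set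
    adj?     : ∀ u v → Dec (Adj u v)
    sym      : ∀ {u v} → Adj u v → Adj v u
    irrefl   : ∀ {u} → ¬ Adj u u

open Graph public

Distinct4 : ∀ {n} → Fin n → Fin n → Fin n → Fin n → Set
Distinct4 a b c d =
  a ≢ b × a ≢ c × a ≢ d × b ≢ c × b ≢ d × c ≢ d

InducedP4 : ∀ {n} → Graph n → Fin n → Fin n → Fin n → Fin n → Set
InducedP4 G a b c d =
  Distinct4 a b c d ×
  Adj G a b × Adj G b c × Adj G c d ×
  ¬ Adj G a c × ¬ Adj G b d × ¬ Adj G a d

InducedC4 : ∀ {n} → Graph n → Fin n → Fin n → Fin n → Fin n → Set
InducedC4 G a b c d =
  Distinct4 a b c d ×
  Adj G a b × Adj G b c × Adj G c d × Adj G d a ×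
  ¬ Adj G a c × ¬ Adj G b d

TriviallyPerfect : ∀ {n} → Graph n → Set
TriviallyPerfect {n} G =
  (∀ a b c d → ¬ InducedC4 G a b c d) × (∀ a b c d → ¬ InducedP4 G a b c d)

InClosedNbhd : ∀ {n} → Graph n → Fin n → Fin n → Set
InClosedNbhd G u w = w ≡ u ⊎ Adj G u w

TrueTwins : ∀ {n} → Graph n → Fin n → Fin n → Set
TrueTwins G u v = ∀ w → InClosedNbhd G u w ⇔ InClosedNbhd G v w

-- Every true twin class has size at most t.  (True twinness is an
-- equivalence relation, so the true twin class of u is exactly the set
-- of true twins of u.)
TwinClassesAtMost : ∀ {n} → Graph n → ℕ → Set
TwinClassesAtMost {n} G t =
  ∀ (u : Fin n) (S : Subset n) → (∀ v → v ∈ S → TrueTwins G u v) → ∣ S ∣ ≤ t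

Independent : ∀ {n} → Graph n → Subset n → Set
Independent G S = ∀ u v → u ∈ S → v ∈ S → ¬ Adj G u v

IndependenceNumber : ∀ {n} → Graph n → ℕ → Set
IndependenceNumber {n} G α =
  Σ (Subset n) (λ S → Independent G S × ∣ S ∣ ≡ α) ×
  (∀ (S : Subset n) → Independent G S → ∣ S ∣ ≤ α)

-- In a trivially perfect graph the closed neighbourhoods of adjacent vertices are
-- nested.  Consequently, if v ∈ X has the most neighbours inside X, there are no
-- edges between X ∩ N[v] and X ∖ N[v]: either v is universal in X or X splits into
-- two parts with no edges between them.  In a module X (every vertex outside X sees
-- all of X or none of it) the universal vertices are pairwise true twins, hence at
-- most t of them, and removing them leaves a smaller module that splits.  Induction
-- gives an independent I ⊆ X with |X| + t ≤ 2|I|t, and a split X even satisfies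
-- |X| + 2t ≤ 2|I|t, which pays for the universal vertices.
module Submission where

open import Defs
open import Data.Nat using (ℕ; zero; suc; _≤_; _*_; _∸_; _+_; z≤n; s≤s)
open import Data.Nat.Properties
open import Data.Nat.Tactic.RingSolver using (solve-∀)
open import Data.Fin using (Fin; zero; suc)
open import Data.Fin.Properties using (any?; all?) renaming (_≟_ to _≟ᶠ_)
open import Data.Fin.Subset
  using (Subset; _∈_; _∉_; ∣_∣; _∪_; _⊆_; _⊂_; ⁅_⁆; ⊤; inside; outside; Nonempty)
open import Data.Fin.Subset.Properties
  using (_∈?_; p⊆q⇒∣p∣≤∣q∣; p⊂q⇒∣p∣<∣q∣; ⊂-trans; x∈p∪q⁺; x∈p∪q⁻; x∈⁅y⁆⇒x≡y;
         ∣⁅x⁆∣≡1; nonempty?; ∈⊤; ∣⊤∣≡n)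
open import Data.Fin.Subset.Induction using (⊂-wellFounded)
open import Data.Vec.Base using ([]; _∷_; here; there)
open import Data.List.Base using (List; allFin; filter)
open import Data.List.Extrema.Nat using (argmax; argmax-all; f[xs]≤f[argmax])
open import Data.List.Relation.Unary.All using (lookup)
open import Data.List.Relation.Unary.All.Properties using (all-filter)
open import Data.List.Membership.Propositional.Properties using (∈-allFin; ∈-filter⁺)
open import Data.Product using (_×_; ∃; ∃-syntax; _,_; proj₁; proj₂)
open import Data.Sum using (_⊎_; inj₁; inj₂; [_,_]′)
open import Data.Empty using (⊥; ⊥-elim)
open import Function.Base using (_∘_; id)
open import Function.Bundles using (mk⇔)
open import Induction.WellFounded using (Acc; acc; WfRec)
open import Level using (0ℓ)
open import Relation.Nullary using (¬_; Dec; yes; no)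
open import Relation.Nullary.Decidable using (_×-dec_; _⊎-dec_; _→-dec_; ¬?; decidable-stable; toSum)
open import Relation.Unary using (Pred; Decidable)
open import Relation.Binary.PropositionalEquality
  using (_≡_; _≢_; refl; subst; cong) renaming (sym to ≡-sym)

private
  variable
    n : ℕ

subset : {P : Pred (Fin n) 0ℓ} → Decidable P → Subset n
subset {zero}  P? = []
subset {suc n} P? with P? zero
... | yes _ = inside ∷ subset (P? ∘ suc)
... | no _  = outside ∷ subset (P? ∘ suc)

∈-subset⁺ : {P : Pred (Fin n) 0ℓ} (P? : Decidable P) → ∀ {x} → P x → x ∈ subset P?
∈-subset⁺ P? {zero} p with P? zero
... | yes _ = here
... | no ¬p = ⊥-elim (¬p p)
∈-subset⁺ P? {suc x} p with P? zero
... | yes _ = there (∈-subset⁺ (P? ∘ suc) p)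
... | no _  = there (∈-subset⁺ (P? ∘ suc) p)

∈-subset⁻ : {P : Pred (Fin n) 0ℓ} (P? : Decidable P) → ∀ {x} → x ∈ subset P? → P x
∈-subset⁻ P? {zero} x∈ with P? zero | x∈
... | yes p | _ = p
... | no _  | ()
∈-subset⁻ P? {suc x} x∈ with P? zero | x∈
... | yes _ | there x∈′ = ∈-subset⁻ (P? ∘ suc) x∈′
... | no _  | there x∈′ = ∈-subset⁻ (P? ∘ suc) x∈′

∣p∪q∣≤∣p∣+∣q∣ : (p q : Subset n) → ∣ p ∪ q ∣ ≤ ∣ p ∣ + ∣ q ∣
∣p∪q∣≤∣p∣+∣q∣ []            []            = z≤n
∣p∪q∣≤∣p∣+∣q∣ (inside ∷ p)  (inside ∷ q)  = s≤s (≤-trans (∣p∪q∣≤∣p∣+∣q∣ p q) (+-monoʳ-≤ ∣ p ∣ (n≤1+n ∣ q ∣)))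
∣p∪q∣≤∣p∣+∣q∣ (inside ∷ p)  (outside ∷ q) = s≤s (∣p∪q∣≤∣p∣+∣q∣ p q)
∣p∪q∣≤∣p∣+∣q∣ (outside ∷ p) (inside ∷ q)  = ≤-trans (s≤s (∣p∪q∣≤∣p∣+∣q∣ p q)) (≤-reflexive (≡-sym (+-suc ∣ p ∣ ∣ q ∣)))
∣p∪q∣≤∣p∣+∣q∣ (outside ∷ p) (outside ∷ q) = ∣p∪q∣≤∣p∣+∣q∣ p q

disjoint⇒∣p∣+∣q∣≤∣p∪q∣ : (p q : Subset n) → (∀ {x} → x ∈ p → x ∉ q) → ∣ p ∣ + ∣ q ∣ ≤ ∣ p ∪ q ∣
disjoint⇒∣p∣+∣q∣≤∣p∪q∣ []            []            _ = z≤n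
disjoint⇒∣p∣+∣q∣≤∣p∪q∣ (inside ∷ p)  (inside ∷ q)  d = ⊥-elim (d here here)
disjoint⇒∣p∣+∣q∣≤∣p∪q∣ (inside ∷ p)  (outside ∷ q) d = s≤s (disjoint⇒∣p∣+∣q∣≤∣p∪q∣ p q (λ x∈p → d (there x∈p) ∘ there))
disjoint⇒∣p∣+∣q∣≤∣p∪q∣ (outside ∷ p) (inside ∷ q)  d =
  ≤-trans (≤-reflexive (+-suc ∣ p ∣ ∣ q ∣)) (s≤s (disjoint⇒∣p∣+∣q∣≤∣p∪q∣ p q (λ x∈p → d (there x∈p) ∘ there)))
disjoint⇒∣p∣+∣q∣≤∣p∪q∣ (outside ∷ p) (outside ∷ q) d = disjoint⇒∣p∣+∣q∣≤∣p∪q∣ p q (λ x∈p → d (there x∈p) ∘ there)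

split-bound : ∀ {x t} a b i j → x ≤ a + b → a + t ≤ 2 * i * t → b + t ≤ 2 * j * t →
              x + (t + t) ≤ 2 * (i + j) * t
split-bound {x} {t} a b i j x≤a+b a+t≤ b+t≤ = begin
  x + (t + t)            ≤⟨ +-monoˡ-≤ (t + t) x≤a+b ⟩
  a + b + (t + t)        ≡⟨ interchange a b t ⟩
  (a + t) + (b + t)      ≤⟨ +-mono-≤ a+t≤ b+t≤ ⟩
  2 * i * t + 2 * j * t  ≡⟨ *-distribʳ-+ t (2 * i) (2 * j) ⟨
  (2 * i + 2 * j) * t    ≡⟨ cong (_* t) (*-distribˡ-+ 2 i j) ⟨
  2 * (i + j) * t        ∎
  where
    open ≤-Reasoning
    interchange : ∀ a b t → a + b + (t + t) ≡ (a + t) + (b + t)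
    interchange = solve-∀

m+t≤k*t⇒m≤[k∸1]*t : ∀ m t k → m + t ≤ k * t → m ≤ (k ∸ 1) * t
m+t≤k*t⇒m≤[k∸1]*t m t k m+t≤k*t = begin
  m              ≤⟨ m+n≤o⇒m≤o∸n m m+t≤k*t ⟩
  k * t ∸ t      ≡⟨ cong (k * t ∸_) (*-identityˡ t) ⟨
  k * t ∸ 1 * t  ≡⟨ *-distribʳ-∸ t k 1 ⟨
  (k ∸ 1) * t    ∎
  where open ≤-Reasoning

maximiser : (X : Subset n) (f : Fin n → ℕ) → Nonempty X → ∃[ v ] v ∈ X × (∀ {u} → u ∈ X → f u ≤ f v)
maximiser {n} X f (x , x∈X) =
  argmax f x xs , argmax-all f x∈X (all-filter (_∈? X) (allFin n)) ,
  λ u∈X → lookup (f[xs]≤f[argmax] x xs) (∈-filter⁺ (_∈? X) (∈-allFin _) u∈X)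
  where
    xs : List (Fin n)
    xs = filter (_∈? X) (allFin n)

module _ (G : Graph n) where

  infix 4 N[_]∋_ N[_]∋?_

  N[_]∋_ : Fin n → Fin n → Set
  N[_]∋_ = InClosedNbhd G

  N[_]∋?_ : ∀ u w → Dec (N[ u ]∋ w)
  N[ u ]∋? w = (w ≟ᶠ u) ⊎-dec adj? G u w

  N[]-sym : ∀ {u w} → N[ u ]∋ w → N[ w ]∋ u
  N[]-sym (inj₁ refl) = inj₁ refl
  N[]-sym (inj₂ uw)   = inj₂ (sym G uw)

  adj⇒≢ : ∀ {u w} → Adj G u w → u ≢ w
  adj⇒≢ uw refl = irrefl G uw

  independent-∪ : ∀ {I J} → Independent G I → Independent G J →
                  (∀ {a b} → a ∈ I → b ∈ J → ¬ Adj G a b) → Independent G (I ∪ J)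
  independent-∪ {I} {J} indI indJ sep u w u∈ w∈ with x∈p∪q⁻ I J u∈ | x∈p∪q⁻ I J w∈
  ... | inj₁ u∈I | inj₁ w∈I = indI u w u∈I w∈I
  ... | inj₂ u∈J | inj₂ w∈J = indJ u w u∈J w∈J
  ... | inj₁ u∈I | inj₂ w∈J = sep u∈I w∈J
  ... | inj₂ u∈J | inj₁ w∈I = sep w∈I u∈J ∘ sym G

  independent-⁅⁆ : ∀ v → Independent G ⁅ v ⁆
  independent-⁅⁆ v u w u∈ w∈ with x∈⁅y⁆⇒x≡y v u∈ | x∈⁅y⁆⇒x≡y v w∈
  ... | refl | refl = irrefl G

  _∩N[_] : Subset n → Fin n → Subset n
  X ∩N[ u ] = subset (λ y → (y ∈? X) ×-dec (N[ u ]∋? y))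

  _∖N[_] : Subset n → Fin n → Subset n
  X ∖N[ u ] = subset (λ y → (y ∈? X) ×-dec ¬? (N[ u ]∋? y))

  Homogeneous : Fin n → Subset n → Set
  Homogeneous x X = ∀ {u w} → u ∈ X → w ∈ X → Adj G x u → Adj G x w

  Module : Subset n → Set
  Module X = ∀ {x} → x ∉ X → Homogeneous x X

  module-⊆ : ∀ {X Y} → Module X → Y ⊆ X → (∀ {x} → x ∈ X → x ∉ Y → Homogeneous x Y) → Module Y
  module-⊆ {X} M Y⊆X inside-X {x} x∉Y with x ∈? X
  ... | yes x∈X = inside-X x∈X x∉Y
  ... | no x∉X  = λ u∈Y w∈Y → M x∉X (Y⊆X u∈Y) (Y⊆X w∈Y)

  Universal : Subset n → Fin n → Set
  Universal X v = v ∈ X × (∀ y → y ∈ X → N[ v ]∋ y)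

  Universal? : ∀ X → Decidable (Universal X)
  Universal? X v = (v ∈? X) ×-dec all? (λ y → (y ∈? X) →-dec (N[ v ]∋? y))

  universal-N[]⊆ : ∀ {X u w} → Module X → Universal X u → Universal X w → ∀ {z} → N[ u ]∋ z → N[ w ]∋ z
  universal-N[]⊆ {X} M (u∈X , _) (w∈X , w-univ) {z} u∋z with z ∈? X
  ... | yes z∈X = w-univ z z∈X
  ... | no z∉X with u∋z
  ...   | inj₁ refl = ⊥-elim (z∉X u∈X)
  ...   | inj₂ uz   = inj₂ (sym G (M z∉X u∈X w∈X (sym G uz)))

  universal-twins : ∀ {X u w} → Module X → Universal X u → Universal X w → TrueTwins G u w
  universal-twins M U W z = mk⇔ (universal-N[]⊆ M U W) (universal-N[]⊆ M W U)

  universals : Subset n → Subset n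
  universals X = subset (Universal? X)

  nonuniversals : Subset n → Subset n
  nonuniversals X = subset (λ y → (y ∈? X) ×-dec ¬? (Universal? X y))

  record Split (X : Subset n) : Set where
    field
      A B        : Subset n
      A⊆X        : A ⊆ X
      B⊆X        : B ⊆ X
      covers     : ∀ {x} → x ∈ X → x ∈ A ⊎ x ∈ B
      disjoint   : ∀ {x} → x ∈ A → x ∉ B
      separated  : ∀ {a b} → a ∈ A → b ∈ B → ¬ Adj G a b
      A-nonempty : Nonempty A
      B-nonempty : Nonempty B

    A⊂X : A ⊂ X
    A⊂X = let b , b∈B = B-nonempty in A⊆X , b , B⊆X b∈B , λ b∈A → disjoint b∈A b∈B

    B⊂X : B ⊂ X
    B⊂X = let a , a∈A = A-nonempty in B⊆X , a , A⊆X a∈A , disjoint a∈A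

    A-module : Module X → Module A
    A-module M = module-⊆ M A⊆X λ x∈X x∉A u∈A _ xu → ⊥-elim (separated u∈A (B-of x∈X x∉A) (sym G xu))
      where
        B-of : ∀ {x} → x ∈ X → x ∉ A → x ∈ B
        B-of x∈X x∉A = [ ⊥-elim ∘ x∉A , id ]′ (covers x∈X)

    B-module : Module X → Module B
    B-module M = module-⊆ M B⊆X λ x∈X x∉B u∈B _ xu → ⊥-elim (separated (A-of x∈X x∉B) u∈B xu)
      where
        A-of : ∀ {x} → x ∈ X → x ∉ B → x ∈ A
        A-of x∈X x∉B = [ id , ⊥-elim ∘ x∉B ]′ (covers x∈X)

  nonuniversals⊆ : ∀ {X} → nonuniversals X ⊆ X
  nonuniversals⊆ = proj₁ ∘ ∈-subset⁻ _

  nonuniversals⊂ : ∀ {X v} → Universal X v → nonuniversals X ⊂ X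
  nonuniversals⊂ {v = v} U = nonuniversals⊆ , v , proj₁ U , λ v∈ → proj₂ (∈-subset⁻ _ v∈) U

  ⊆universals∪nonuniversals : ∀ {X} → X ⊆ universals X ∪ nonuniversals X
  ⊆universals∪nonuniversals {X} {y} y∈X with Universal? X y
  ... | yes U = x∈p∪q⁺ (inj₁ (∈-subset⁺ _ U))
  ... | no ¬U = x∈p∪q⁺ (inj₂ (∈-subset⁺ _ (y∈X , ¬U)))

  ∉nonuniversals⇒universal : ∀ {X x} → x ∈ X → x ∉ nonuniversals X → Universal X x
  ∉nonuniversals⇒universal {X} {x} x∈X x∉R =
    decidable-stable (Universal? X x) λ ¬U → x∉R (∈-subset⁺ _ (x∈X , ¬U))

  ¬Nonempty[nonuniversals]⇒⊆universals : ∀ {X} → ¬ Nonempty (nonuniversals X) → X ⊆ universals X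
  ¬Nonempty[nonuniversals]⇒⊆universals R=∅ {y} y∈X =
    ∈-subset⁺ _ (∉nonuniversals⇒universal y∈X (R=∅ ∘ (y ,_)))

  nonuniversals-module : ∀ {X} → Module X → Module (nonuniversals X)
  nonuniversals-module {X} M = module-⊆ M nonuniversals⊆ adjacent-to-all
    where
      adjacent-to-all : ∀ {x} → x ∈ X → x ∉ nonuniversals X → Homogeneous x (nonuniversals X)
      adjacent-to-all x∈X x∉R _ w∈R _ =
        let Ux = ∉nonuniversals⇒universal x∈X x∉R
            w∈X , ¬Uw = ∈-subset⁻ _ w∈R
        in [ (λ { refl → ⊥-elim (¬Uw Ux) }) , id ]′ (proj₂ Ux _ w∈X)

  nonuniversals-¬universal : ∀ {X u} → ¬ Universal (nonuniversals X) u
  nonuniversals-¬universal {X} {u} (u∈R , u-univ) with ∈-subset⁻ _ u∈R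
  ... | u∈X , ¬Uu = ¬Uu (u∈X , u∋)
    where
      u∋ : ∀ y → y ∈ X → N[ u ]∋ y
      u∋ y y∈X with Universal? X y
      ... | yes (_ , y-univ) = N[]-sym (y-univ u u∈X)
      ... | no ¬Uy = u-univ y (∈-subset⁺ _ (y∈X , ¬Uy))

  module _ (tp : TriviallyPerfect G) where

    nbhds-nested : ∀ {v a b c} → Adj G v a → N[ v ]∋ c → ¬ N[ a ]∋ c → N[ a ]∋ b → ¬ N[ v ]∋ b → ⊥
    nbhds-nested {v} {a} {b} {c} va v∋c ¬a∋c a∋b ¬v∋b = closing (adj? G b c)
      where
        cv : Adj G c v
        cv = [ (λ { refl → ⊥-elim (¬a∋c (inj₂ (sym G va))) }) , sym G ]′ v∋c

        ab : Adj G a b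
        ab = [ (λ { refl → ⊥-elim (¬v∋b (inj₂ va)) }) , id ]′ a∋b

        ¬ca : ¬ Adj G c a
        ¬ca = ¬a∋c ∘ inj₂ ∘ sym G

        ¬vb : ¬ Adj G v b
        ¬vb = ¬v∋b ∘ inj₂

        distinct : Distinct4 c v a b
        distinct = adj⇒≢ cv , ¬a∋c ∘ inj₁ , (λ { refl → ¬vb (sym G cv) }) ,
                   adj⇒≢ va , ¬v∋b ∘ inj₁ ∘ ≡-sym , adj⇒≢ ab

        closing : Dec (Adj G b c) → ⊥
        closing (yes bc) = proj₁ tp c v a b (distinct , cv , va , ab , bc , ¬ca , ¬vb)
        closing (no ¬bc) = proj₂ tp c v a b (distinct , cv , va , ab , ¬ca , ¬vb , ¬bc ∘ sym G)

    max-nbhd-separates : ∀ {X v} → (∀ {u} → u ∈ X → ∣ X ∩N[ u ] ∣ ≤ ∣ X ∩N[ v ] ∣) →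
                         ∀ {a b} → a ∈ X → N[ v ]∋ a → b ∈ X → ¬ N[ v ]∋ b → ¬ Adj G a b
    max-nbhd-separates _ _ (inj₁ refl) _ ¬v∋b ab = ¬v∋b (inj₂ ab)
    max-nbhd-separates {X} {v} v-max {a} {b} a∈X (inj₂ va) b∈X ¬v∋b ab
      with any? (λ c → (c ∈? X) ×-dec (N[ v ]∋? c) ×-dec ¬? (N[ a ]∋? c))
    ... | yes (_ , _ , v∋c , ¬a∋c) = nbhds-nested va v∋c ¬a∋c (inj₂ ab) ¬v∋b
    ... | no ¬c = <⇒≱ (p⊂q⇒∣p∣<∣q∣ X∩N[v]⊂X∩N[a]) (v-max a∈X)
      where
        X∩N[v]⊆X∩N[a] : X ∩N[ v ] ⊆ X ∩N[ a ]
        X∩N[v]⊆X∩N[a] {y} y∈ with ∈-subset⁻ _ y∈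
        ... | y∈X , v∋y = ∈-subset⁺ _ (y∈X , decidable-stable (N[ a ]∋? y) λ ¬a∋y → ¬c (y , y∈X , v∋y , ¬a∋y))

        X∩N[v]⊂X∩N[a] : X ∩N[ v ] ⊂ X ∩N[ a ]
        X∩N[v]⊂X∩N[a] = X∩N[v]⊆X∩N[a] , b , ∈-subset⁺ _ (b∈X , inj₂ ab) , ¬v∋b ∘ proj₂ ∘ ∈-subset⁻ _

    universal⊎split : ∀ {X} → Nonempty X → ∃ (Universal X) ⊎ Split X
    universal⊎split {X} X≠∅ with maximiser X (λ u → ∣ X ∩N[ u ] ∣) X≠∅
    ... | v , v∈X , v-max with any? (λ y → (y ∈? X) ×-dec ¬? (N[ v ]∋? y))
    ...   | no ∄b = inj₁ (v , v∈X , λ y y∈X → decidable-stable (N[ v ]∋? y) λ ¬v∋y → ∄b (y , y∈X , ¬v∋y))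
    ...   | yes (b , b∈X , ¬v∋b) = inj₂ record
      { A          = X ∩N[ v ]
      ; B          = X ∖N[ v ]
      ; A⊆X        = proj₁ ∘ ∈-subset⁻ _
      ; B⊆X        = proj₁ ∘ ∈-subset⁻ _
      ; covers     = λ {y} y∈X → [ (λ v∋y → inj₁ (∈-subset⁺ _ (y∈X , v∋y)))
                                  , (λ ¬v∋y → inj₂ (∈-subset⁺ _ (y∈X , ¬v∋y))) ]′ (toSum (N[ v ]∋? y))
      ; disjoint   = λ y∈A y∈B → proj₂ (∈-subset⁻ _ y∈B) (proj₂ (∈-subset⁻ _ y∈A))
      ; separated  = λ a∈A b∈B → let a∈X , v∋a = ∈-subset⁻ _ a∈A ; b∈X , ¬v∋b = ∈-subset⁻ _ b∈B
                                 in max-nbhd-separates v-max a∈X v∋a b∈X ¬v∋b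
      ; A-nonempty = v , ∈-subset⁺ _ (v∈X , inj₁ refl)
      ; B-nonempty = b , ∈-subset⁺ _ (b∈X , ¬v∋b)
      }

  module _ (t : ℕ) where

    -- |X| + t ≤ 2|I|t is |X| ≤ (2|I| − 1)t stated without truncated subtraction.
    Witness : ℕ → Subset n → Set
    Witness s X = ∃[ I ] I ⊆ X × Independent G I × ∣ X ∣ + s ≤ 2 * ∣ I ∣ * t

    Witness-mono : ∀ {s s′ X} → s ≤ s′ → Witness s′ X → Witness s X
    Witness-mono {X = X} s≤s′ (I , I⊆X , indI , bound) =
      I , I⊆X , indI , ≤-trans (+-monoʳ-≤ ∣ X ∣ s≤s′) bound

    ModuleWitness : Subset n → Set
    ModuleWitness X = Module X → Nonempty X → Witness t X

    split-witness : ∀ {X} (S : Split X) → Witness t (Split.A S) → Witness t (Split.B S) → Witness (t + t) X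
    split-witness {X} S (I , I⊆A , indI , boundI) (J , J⊆B , indJ , boundJ) =
      I ∪ J ,
      [ A⊆X ∘ I⊆A , B⊆X ∘ J⊆B ]′ ∘ x∈p∪q⁻ I J ,
      independent-∪ indI indJ (λ a∈I b∈J → separated (I⊆A a∈I) (J⊆B b∈J)) ,
      ≤-trans (split-bound (∣ A ∣) (∣ B ∣) (∣ I ∣) (∣ J ∣) ∣X∣≤∣A∣+∣B∣ boundI boundJ)
              (*-monoˡ-≤ t (*-monoʳ-≤ 2 ∣I∣+∣J∣≤∣I∪J∣))
      where
        open Split S
        ∣X∣≤∣A∣+∣B∣ : ∣ X ∣ ≤ ∣ A ∣ + ∣ B ∣
        ∣X∣≤∣A∣+∣B∣ = ≤-trans (p⊆q⇒∣p∣≤∣q∣ (x∈p∪q⁺ ∘ covers)) (∣p∪q∣≤∣p∣+∣q∣ A B)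
        ∣I∣+∣J∣≤∣I∪J∣ : ∣ I ∣ + ∣ J ∣ ≤ ∣ I ∪ J ∣
        ∣I∣+∣J∣≤∣I∪J∣ = disjoint⇒∣p∣+∣q∣≤∣p∪q∣ I J λ x∈I → disjoint (I⊆A x∈I) ∘ J⊆B

    split-module-witness : ∀ {X} → Module X → Split X → WfRec _⊂_ ModuleWitness X → Witness (t + t) X
    split-module-witness M S rec =
      split-witness S (rec A⊂X (A-module M) A-nonempty) (rec B⊂X (B-module M) B-nonempty)
      where open Split S

    module _ (tp : TriviallyPerfect G) (tw : TwinClassesAtMost G t) where

      ∣universals∣≤t : ∀ {X v} → Module X → Universal X v → ∣ universals X ∣ ≤ t
      ∣universals∣≤t M Uv = tw _ _ λ w w∈W → universal-twins M Uv (∈-subset⁻ _ w∈W)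

      all-universal-witness : ∀ {X v} → Module X → Universal X v → ¬ Nonempty (nonuniversals X) → Witness t X
      all-universal-witness {X} {v} M Uv R=∅ = ⁅ v ⁆ , ⁅v⁆⊆X , independent-⁅⁆ v , (begin
        ∣ X ∣ + t          ≤⟨ +-monoˡ-≤ t ∣X∣≤t ⟩
        t + t              ≡⟨ cong (t +_) (+-identityʳ t) ⟨
        2 * 1 * t          ≡⟨ cong (λ k → 2 * k * t) (∣⁅x⁆∣≡1 v) ⟨
        2 * ∣ ⁅ v ⁆ ∣ * t  ∎)
        where
          open ≤-Reasoning
          ⁅v⁆⊆X : ⁅ v ⁆ ⊆ X
          ⁅v⁆⊆X u∈ = subst (_∈ X) (≡-sym (x∈⁅y⁆⇒x≡y v u∈)) (proj₁ Uv)
          ∣X∣≤t : ∣ X ∣ ≤ t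
          ∣X∣≤t = ≤-trans (p⊆q⇒∣p∣≤∣q∣ (¬Nonempty[nonuniversals]⇒⊆universals R=∅)) (∣universals∣≤t M Uv)

      nonuniversals-witness : ∀ {X v} → Module X → Universal X v → Witness (t + t) (nonuniversals X) → Witness t X
      nonuniversals-witness {X} M Uv (I , I⊆R , indI , boundI) = I , nonuniversals⊆ ∘ I⊆R , indI , (begin
        ∣ X ∣ + t                     ≤⟨ +-monoˡ-≤ t ∣X∣≤∣W∣+∣R∣ ⟩
        ∣ universals X ∣ + ∣ R ∣ + t  ≤⟨ +-monoˡ-≤ t (+-monoˡ-≤ ∣ R ∣ (∣universals∣≤t M Uv)) ⟩
        t + ∣ R ∣ + t                 ≡⟨ cong (_+ t) (+-comm t ∣ R ∣) ⟩
        ∣ R ∣ + t + t                 ≡⟨ +-assoc ∣ R ∣ t t ⟩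
        ∣ R ∣ + (t + t)               ≤⟨ boundI ⟩
        2 * ∣ I ∣ * t                 ∎)
        where
          open ≤-Reasoning
          R : Subset n
          R = nonuniversals X
          ∣X∣≤∣W∣+∣R∣ : ∣ X ∣ ≤ ∣ universals X ∣ + ∣ R ∣
          ∣X∣≤∣W∣+∣R∣ = ≤-trans (p⊆q⇒∣p∣≤∣q∣ ⊆universals∪nonuniversals) (∣p∪q∣≤∣p∣+∣q∣ (universals X) R)

      universal-witness : ∀ {X v} → Module X → Universal X v → WfRec _⊂_ ModuleWitness X → Witness t X
      universal-witness {X} M Uv rec with nonempty? (nonuniversals X)
      ... | no R=∅  = all-universal-witness M Uv R=∅
      ... | yes R≠∅ = nonuniversals-witness M Uv
        ([ ⊥-elim ∘ nonuniversals-¬universal ∘ proj₂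
         , (λ S → split-module-witness (nonuniversals-module M) S rec-R)
         ]′ (universal⊎split tp R≠∅))
        where
          rec-R : WfRec _⊂_ ModuleWitness (nonuniversals X)
          rec-R Y⊂R = rec (⊂-trans Y⊂R (nonuniversals⊂ Uv))

      witness : ∀ {X} → Acc _⊂_ X → ModuleWitness X
      witness (acc rs) M X≠∅ =
        [ (λ (_ , U) → universal-witness M U (witness ∘ rs))
        , (λ S → Witness-mono (m≤m+n t t) (split-module-witness M S (witness ∘ rs)))
        ]′ (universal⊎split tp X≠∅)

      order-bound : ∀ α → (∀ S → Independent G S → ∣ S ∣ ≤ α) → Nonempty ⊤ → n + t ≤ 2 * α * t
      order-bound α maximum V≠∅ with witness (⊂-wellFounded ⊤) (λ x∉⊤ → ⊥-elim (x∉⊤ ∈⊤)) V≠∅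
      ... | I , _ , indI , bound = begin
        n + t          ≡⟨ cong (_+ t) (∣⊤∣≡n n) ⟨
        ∣ ⊤ {n} ∣ + t  ≤⟨ bound ⟩
        2 * ∣ I ∣ * t  ≤⟨ *-monoˡ-≤ t (*-monoʳ-≤ 2 (maximum I indI)) ⟩
        2 * α * t      ∎
        where open ≤-Reasoning

lemma13 : (n t α : ℕ) (G : Graph n) →
    TriviallyPerfect G →
    TwinClassesAtMost G t →
    IndependenceNumber G α →
    n ≤ (2 * α ∸ 1) * t
lemma13 zero    t α G tp tw _ = z≤n
lemma13 (suc n) t α G tp tw (_ , maximum) =
  m+t≤k*t⇒m≤[k∸1]*t (suc n) t (2 * α) (order-bound G t tp tw α maximum (zero , ∈⊤))
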